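{- For each integer $m\geqslant0$, $$\delta([\underbrace{2,\ldots,2}_m])=\sum_{\mathbf{a}\in\mathcal{A}_{2m}^{\{2,4\}}}c_{\mathbf{a}}\,\mathbf{a},$$ where $\mathcal{A}_{2m}^{\{2,4\}}$ is the set of compositions of weight $2m$ all of whose entries belong to $\{2,4\}$, and for such $\mathbf{a}=(a_1,\ldots,a_r)$, $c_{\mathbf{a}}=3\cdot2^{s-1}$ if $a_1=2$ and $c_{\mathbf{a}}=2^s$ otherwise, with $s=2r-m$ the number of indices $i$ with $a_i=2$.
   Context: A composition is a finite sequence $\mathbf{a}=(a_1,\ldots,a_r)$ of positive integers ($r\geqslant0$), of weight $\sum a_i$; admissible if $r=0$ or $a_1\geqslant2$. $\mathcal{A}$ (resp. $\mathcal{A}_k$) is the set of admissible compositions (resp. of weight $k$). Binary word $\mathbf{w}(\mathbf{a})=0^{a_1-1}1\cdots0^{a_r-1}1$; the dual of a word $\varepsilon_1\cdots\varepsilon_k$ is $\overline{\varepsilon_k}\cdots\overline{\varepsilon_1}$ ($\overline0=1,\overline1=0$); $\overline{\mathbf{a}}$ is the admissible composition with word dual to $\mathbf{w}(\mathbf{a})$. $\mathcal{B}=\mathcal{A}/(\mathbf{a}\sim\overline{\mathbf{a}})$, classes $[\mathbf{a}]$, $\mathcal{B}_k$ classes of weight $k$; $\mathbf{Z}^{(X)}$ is the free $\mathbf{Z}$-module on $X$. $(a_1,\ldots,a_r)^{\rm init}=(a_1,\ldots,a_{r-1})$ ($\varnothing^{\rm init}=\varnothing$); for admissible $\mathbf{a}$,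 $\mathbf{a}^{\rm fin}$ is the dual of $(\overline{\mathbf{a}})^{\rm init}$ and $\mathbf{a}^{\rm mid}=(\mathbf{a}^{\rm fin})^{\rm init}$; extended $\mathbf{Z}$-linearly. $\delta$ is the unique $\mathbf{Z}$-linear map $\mathbf{Z}^{(\mathcal{B})}\to\mathbf{Z}^{(\mathcal{A})}$ with $\delta(\mathbf{Z}^{\mathcal{B}_k})\subset\mathbf{Z}^{\mathcal{A}_k}$ for all $k$, $\delta([\varnothing])=\varnothing$, and $\delta([\mathbf{a}])^{\rm init}=\delta([\mathbf{a}^{\rm init}])+\delta([\mathbf{a}^{\rm mid}])+\delta([\mathbf{a}^{\rm fin}])$ for all non-empty admissible $\mathbf{a}$. -}

module Defs where

open import Data.Nat using (ℕ; zero; suc; _+_; _*_; _∸_; _^_; _≡ᵇ_; _≤ᵇ_)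
open import Data.Bool using (Bool; true; false; not; _∧_; _∨_; if_then_else_)
open import Data.List using (List; []; _∷_; _++_; length; filter; reverse; map; replicate)
open import Data.Nat.ListAction using (sum)
open import Data.Integer using (ℤ; +_) renaming (_+_ to _+ℤ_)

-- Compositions are lists of natural numbers (entries of admissible
-- compositions are positive); a formal ℤ-linear combination of compositions
-- is represented by its coefficient function  List ℕ → ℤ .
Composition : Set
Composition = List ℕ

Comb : Set
Comb = Composition → ℤ

-- Binary words; true = letter 1, false = letter 0.
Word : Set
Word = List Bool

toWord : Composition → Word
toWord [] = []
toWord (a ∷ as) = replicate (a ∸ 1) false ++ (true ∷ toWord as)

-- inverse of toWord on words ending in 1 (or empty): reads 0^{k}1 as k+1
fromWord′ : ℕ → Word → Composition
fromWord′ k [] = []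
fromWord′ k (false ∷ w) = fromWord′ (suc k) w
fromWord′ k (true ∷ w) = suc k ∷ fromWord′ 0 w

fromWord : Word → Composition
fromWord = fromWord′ 0

dualWord : Word → Word
dualWord w = reverse (map not w)

dual : Composition → Composition
dual a = fromWord (dualWord (toWord a))

weight : Composition → ℕ
weight = sum

init : Composition → Composition
init [] = []
init (x ∷ []) = []
init (x ∷ y ∷ xs) = x ∷ init (y ∷ xs)

lastEntry : Composition → ℕ
lastEntry [] = 0
lastEntry (x ∷ []) = x
lastEntry (x ∷ y ∷ xs) = lastEntry (y ∷ xs)

fin : Composition → Composition
fin a = dual (init (dual a))

mid : Composition → Composition
mid a = init (fin a)

isEmpty : Composition → Bool
isEmpty [] = true
isEmpty (_ ∷ _) = false

-- δ, computed on a representative a of the class [a], with a fuel argument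
-- (fuel ≥ weight suffices).  The defining relation
--   δ([a])^init = δ([a^init]) + δ([a^mid]) + δ([a^fin])
-- together with δ([a]) ∈ ℤ^{A_k} (k = weight a ≥ 1) determines δ([a]):
-- since init is injective on compositions of a fixed weight k ≥ 1, the
-- coefficient of b in δ([a]) is the coefficient of b^init in the right-hand
-- side when b is non-empty of weight k with positive last entry, and 0
-- otherwise.
δfuel : ℕ → Composition → Comb
δfuel _ [] b = if isEmpty b then + 1 else + 0
δfuel zero (_ ∷ _) b = + 0
δfuel (suc n) (_ ∷ _) [] = + 0
δfuel (suc n) a@(_ ∷ _) b@(_ ∷ _) =
  if (weight b ≡ᵇ weight a) ∧ (1 ≤ᵇ lastEntry b)
  then δfuel n (init a) (init b) +ℤ δfuel n (mid a) (init b) +ℤ δfuel n (fin a) (init b)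
  else + 0

δ : Composition → Comb
δ a = δfuel (weight a) a

is24 : ℕ → Bool
is24 x = (x ≡ᵇ 2) ∨ (x ≡ᵇ 4)

all24 : Composition → Bool
all24 [] = true
all24 (x ∷ xs) = is24 x ∧ all24 xs

count2 : Composition → ℕ
count2 a = length (filter (λ x → x Data.Nat.≟ 2) a)

startsWith2 : Composition → Bool
startsWith2 [] = false
startsWith2 (x ∷ _) = x ≡ᵇ 2

cCoeff : Composition → ℕ
cCoeff a = if startsWith2 a then 3 * 2 ^ (count2 a ∸ 1) else 2 ^ count2 a

rhs : ℕ → Comb
rhs m b = if all24 b ∧ (weight b ≡ᵇ 2 * m) then + cCoeff b else + 0

-- The word of (2,…,2) = 2ᵏ is (01)ᵏ, which is self-dual; hence init and fin
-- both send 2ᵏ to 2ᵏ⁻¹ and mid sends it to 2ᵏ⁻², so δ(2ᵏ⁺¹) is the element of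
-- weight 2k+2 whose init is 2·δ(2ᵏ) + δ(2ᵏ⁻¹) (for k = 0 this reads 3·δ(∅),
-- since then mid (2) = ∅).  The right-hand side obeys the same recurrence:
-- a {2,4}-composition of weight 2k+2 is c ++ (2) with c of weight 2k, or
-- c ++ (4) with c of weight 2k−2; appending a 4 leaves c_a unchanged and
-- appending a 2 doubles it, except that c_(2) = 3 = 3·c_∅.
module Submission where

open import Defs
open import Data.Bool using (true; false; not; _∧_; _∨_; if_then_else_)
open import Data.Bool.Properties
  using (∧-assoc; ∧-identityʳ; ∧-zeroʳ; if-cong; if-cong-then; if-float)
open import Data.Integer using (ℤ; +_) renaming (_+_ to _+ℤ_)
import Data.Integer.Properties as ℤ
open import Data.List using ([]; _∷_; _++_; _∷ʳ_; replicate; reverse; map; filter; length)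
open import Data.List.Properties using (++-assoc; unfold-reverse; filter-++; length-++)
open import Data.List.Reverse using (reverseView; []; _∶_∶ʳ_)
open import Data.Nat using (ℕ; zero; suc; _+_; _*_; _∸_; _^_; _≡ᵇ_; _≤ᵇ_; _≤_; _≟_; s≤s)
open import Data.Nat.ListAction.Properties using (sum-++)
open import Data.Nat.Properties
  using ( +-identityʳ; +-comm; +-assoc; *-assoc; *-suc; +-cancelˡ-≡; +-cancelʳ-≡
        ; *-cancelˡ-≡; 1+n≢n; m≤m+n; ≤-trans; m∸n≤m)
open import Function using (_∘_)
open import Relation.Nullary using (yes; no; contradiction)
open import Relation.Nullary.Decidable using (dec-true; dec-false)
open import Relation.Binary.PropositionalEquality

≡ᵇ-true : ∀ {m n} → m ≡ n → (m ≡ᵇ n) ≡ true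
≡ᵇ-true {m} {n} = dec-true (m ≟ n)

≡ᵇ-false : ∀ {m n} → m ≢ n → (m ≡ᵇ n) ≡ false
≡ᵇ-false {m} {n} = dec-false (m ≟ n)

+-cancel-≡ : ∀ {m n x y} → m ≡ n → m + x ≡ n + y → x ≡ y
+-cancel-≡ {m} refl = +-cancelˡ-≡ m _ _

2*-suc : ∀ k → 2 * suc k ≡ 2 * k + 2
2*-suc k = trans (*-suc 2 k) (+-comm 2 (2 * k))

2*-suc-suc : ∀ k → 2 * suc (suc k) ≡ 2 * k + 4
2*-suc-suc k = trans (2*-suc (suc k)) (trans (cong (_+ 2) (2*-suc k)) (+-assoc (2 * k) 2 2))

2*-suc≢2* : ∀ k → 2 * suc k ≢ 2 * k
2*-suc≢2* k = 1+n≢n ∘ *-cancelˡ-≡ (suc k) k 2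

init-∷ʳ : ∀ c x → init (c ∷ʳ x) ≡ c
init-∷ʳ [] x = refl
init-∷ʳ (y ∷ []) x = refl
init-∷ʳ (y ∷ z ∷ zs) x = cong (y ∷_) (init-∷ʳ (z ∷ zs) x)

lastEntry-∷ʳ : ∀ c x → lastEntry (c ∷ʳ x) ≡ x
lastEntry-∷ʳ [] x = refl
lastEntry-∷ʳ (y ∷ []) x = refl
lastEntry-∷ʳ (y ∷ z ∷ zs) x = lastEntry-∷ʳ (z ∷ zs) x

weight-∷ʳ : ∀ c x → weight (c ∷ʳ x) ≡ weight c + x
weight-∷ʳ c x = trans (sum-++ c (x ∷ [])) (cong (λ n → weight c + n) (+-identityʳ x))

all24-∷ʳ : ∀ c x → all24 (c ∷ʳ x) ≡ all24 c ∧ is24 x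
all24-∷ʳ [] x = ∧-identityʳ (is24 x)
all24-∷ʳ (y ∷ ys) x =
  trans (cong (is24 y ∧_) (all24-∷ʳ ys x)) (sym (∧-assoc (is24 y) (all24 ys) (is24 x)))

is24-false : ∀ x → x ≢ 2 → x ≢ 4 → is24 x ≡ false
is24-false x x≢2 x≢4 = cong₂ _∨_ (≡ᵇ-false x≢2) (≡ᵇ-false x≢4)

all24-∷ʳ-false : ∀ c {x} → is24 x ≡ false → all24 (c ∷ʳ x) ≡ false
all24-∷ʳ-false c {x} x∉ = trans (all24-∷ʳ c x) (trans (cong (all24 c ∧_) x∉) (∧-zeroʳ (all24 c)))

count2-∷ʳ : ∀ c x → count2 (c ∷ʳ x) ≡ count2 c + count2 (x ∷ [])
count2-∷ʳ c x = trans (cong length (filter-++ (_≟ 2) c (x ∷ []))) (length-++ (filter (_≟ 2) c))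

init-replicate : ∀ k x → init (replicate k x) ≡ replicate (k ∸ 1) x
init-replicate zero x = refl
init-replicate (suc zero) x = refl
init-replicate (suc (suc k)) x = cong (x ∷_) (init-replicate (suc k) x)

weight-replicate-2 : ∀ k → weight (replicate k 2) ≡ 2 * k
weight-replicate-2 zero = refl
weight-replicate-2 (suc k) = trans (cong (λ n → 2 + n) (weight-replicate-2 k)) (sym (*-suc 2 k))

toWord-replicate-2-∷ʳ : ∀ k →
  toWord (replicate k 2) ++ false ∷ true ∷ [] ≡ false ∷ true ∷ toWord (replicate k 2)
toWord-replicate-2-∷ʳ zero = refl
toWord-replicate-2-∷ʳ (suc k) = cong (λ w → false ∷ true ∷ w) (toWord-replicate-2-∷ʳ k)

dualWord-replicate-2 : ∀ k → dualWord (toWord (replicate k 2)) ≡ toWord (replicate k 2)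
dualWord-replicate-2 zero = refl
dualWord-replicate-2 (suc k) = begin
  reverse (true ∷ false ∷ map not w)         ≡⟨ unfold-reverse true (false ∷ map not w) ⟩
  reverse (false ∷ map not w) ∷ʳ true        ≡⟨ cong (_∷ʳ true) (unfold-reverse false (map not w)) ⟩
  (reverse (map not w) ∷ʳ false) ∷ʳ true     ≡⟨ ++-assoc (reverse (map not w)) (false ∷ []) (true ∷ []) ⟩
  dualWord w ++ false ∷ true ∷ []            ≡⟨ cong (_++ false ∷ true ∷ []) (dualWord-replicate-2 k) ⟩
  w ++ false ∷ true ∷ []                     ≡⟨ toWord-replicate-2-∷ʳ k ⟩
  false ∷ true ∷ w                           ∎
  where
  open ≡-Reasoning
  w = toWord (replicate k 2)

fromWord-toWord-replicate-2 : ∀ k → fromWord (toWord (replicate k 2)) ≡ replicate k 2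
fromWord-toWord-replicate-2 zero = refl
fromWord-toWord-replicate-2 (suc k) = cong (2 ∷_) (fromWord-toWord-replicate-2 k)

dual-replicate-2 : ∀ k → dual (replicate k 2) ≡ replicate k 2
dual-replicate-2 k =
  trans (cong fromWord (dualWord-replicate-2 k)) (fromWord-toWord-replicate-2 k)

fin-replicate-2 : ∀ k → fin (replicate k 2) ≡ replicate (k ∸ 1) 2
fin-replicate-2 k = begin
  dual (init (dual (replicate k 2)))  ≡⟨ cong (dual ∘ init) (dual-replicate-2 k) ⟩
  dual (init (replicate k 2))         ≡⟨ cong dual (init-replicate k 2) ⟩
  dual (replicate (k ∸ 1) 2)          ≡⟨ dual-replicate-2 (k ∸ 1) ⟩
  replicate (k ∸ 1) 2                 ∎
  where open ≡-Reasoning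

mid-replicate-2 : ∀ k → mid (replicate k 2) ≡ replicate (k ∸ 1 ∸ 1) 2
mid-replicate-2 k = trans (cong init (fin-replicate-2 k)) (init-replicate (k ∸ 1) 2)

infixl 6 _⊕_
_⊕_ : Comb → Comb → Comb
(f ⊕ g) b = f b +ℤ g b

-- The element of ℤ^{A_w} whose image under init is f, as in the definition of δ.
init⁻¹ : ℕ → Comb → Comb
init⁻¹ w f b = if (weight b ≡ᵇ w) ∧ (1 ≤ᵇ lastEntry b) then f (init b) else + 0

δfuel-∷ : ∀ n y ys → let a = y ∷ ys in
  δfuel (suc n) a ≗ init⁻¹ (weight a) (δfuel n (init a) ⊕ δfuel n (mid a) ⊕ δfuel n (fin a))
δfuel-∷ n y ys [] = sym (if-cong (∧-zeroʳ (0 ≡ᵇ weight (y ∷ ys))))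
δfuel-∷ n y ys (_ ∷ _) = refl

init⁻¹-cong : ∀ {v w f g} → v ≡ w → f ≗ g → init⁻¹ v f ≗ init⁻¹ w g
init⁻¹-cong {v} refl f≗g b =
  if-cong-then ((weight b ≡ᵇ v) ∧ (1 ≤ᵇ lastEntry b)) (f≗g (init b))

init⁻¹-∷ʳ : ∀ w f c x →
  init⁻¹ w f (c ∷ʳ x) ≡ (if (weight c + x ≡ᵇ w) ∧ (1 ≤ᵇ x) then f c else + 0)
init⁻¹-∷ʳ w f c x rewrite weight-∷ʳ c x | lastEntry-∷ʳ c x | init-∷ʳ c x = refl

cCoeff-∷ʳ-4 : ∀ c → cCoeff (c ∷ʳ 4) ≡ cCoeff c
cCoeff-∷ʳ-4 [] = refl
cCoeff-∷ʳ-4 c@(y ∷ _) =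
  cong (λ s → if y ≡ᵇ 2 then 3 * 2 ^ (s ∸ 1) else 2 ^ s)
       (trans (count2-∷ʳ c 4) (+-identityʳ (count2 c)))

cCoeff-∷ʳ-2 : ∀ y ys → cCoeff ((y ∷ ys) ∷ʳ 2) ≡ 2 * cCoeff (y ∷ ys)
cCoeff-∷ʳ-2 y ys with y ≟ 2
... | yes refl = begin
  3 * 2 ^ count2 (ys ∷ʳ 2)  ≡⟨ cong (λ s → 3 * 2 ^ s) (trans (count2-∷ʳ ys 2) (+-comm (count2 ys) 1)) ⟩
  3 * (2 * 2 ^ count2 ys)   ≡⟨ sym (*-assoc 3 2 (2 ^ count2 ys)) ⟩
  6 * 2 ^ count2 ys         ≡⟨ *-assoc 2 3 (2 ^ count2 ys) ⟩
  2 * (3 * 2 ^ count2 ys)   ∎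
  where open ≡-Reasoning
... | no y≢2 = begin
  cCoeff (c ∷ʳ 2)      ≡⟨ if-cong (≡ᵇ-false y≢2) ⟩
  2 ^ count2 (c ∷ʳ 2)  ≡⟨ cong (2 ^_) (trans (count2-∷ʳ c 2) (+-comm (count2 c) 1)) ⟩
  2 * 2 ^ count2 c     ≡⟨ cong (2 *_) (if-cong (≡ᵇ-false y≢2)) ⟨
  2 * cCoeff c         ∎
  where
  open ≡-Reasoning
  c = y ∷ ys

coeff : Composition → ℤ
coeff b = if all24 b then + cCoeff b else + 0

coeff-∷ʳ-4 : ∀ c → coeff (c ∷ʳ 4) ≡ coeff c
coeff-∷ʳ-4 c = begin
  coeff (c ∷ʳ 4)                                 ≡⟨ if-cong (trans (all24-∷ʳ c 4) (∧-identityʳ (all24 c))) ⟩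
  (if all24 c then + cCoeff (c ∷ʳ 4) else + 0)  ≡⟨ if-cong-then (all24 c) (cong +_ (cCoeff-∷ʳ-4 c)) ⟩
  coeff c                                        ∎
  where open ≡-Reasoning

coeff-∷ʳ-2 : ∀ y ys → coeff ((y ∷ ys) ∷ʳ 2) ≡ coeff (y ∷ ys) +ℤ coeff (y ∷ ys)
coeff-∷ʳ-2 y ys = begin
  coeff (c ∷ʳ 2)                                       ≡⟨ if-cong (trans (all24-∷ʳ c 2) (∧-identityʳ (all24 c))) ⟩
  (if all24 c then + cCoeff (c ∷ʳ 2) else + 0)        ≡⟨ if-cong-then (all24 c) (cong +_ cCoeff-doubles) ⟩
  (if all24 c then + cCoeff c +ℤ + cCoeff c else + 0) ≡⟨ if-float (λ z → z +ℤ z) (all24 c) ⟨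
  coeff c +ℤ coeff c                                   ∎
  where
  open ≡-Reasoning
  c = y ∷ ys
  cCoeff-doubles : cCoeff (c ∷ʳ 2) ≡ cCoeff c + cCoeff c
  cCoeff-doubles = trans (cCoeff-∷ʳ-2 y ys) (cong (λ n → cCoeff c + n) (+-identityʳ (cCoeff c)))

rhs-on : ∀ m b → weight b ≡ 2 * m → rhs m b ≡ coeff b
rhs-on m b w = if-cong (trans (cong (all24 b ∧_) (≡ᵇ-true w)) (∧-identityʳ (all24 b)))

rhs-off : ∀ m b → weight b ≢ 2 * m → rhs m b ≡ + 0
rhs-off m b w≢ = if-cong (trans (cong (all24 b ∧_) (≡ᵇ-false w≢)) (∧-zeroʳ (all24 b)))

rhs-non24 : ∀ m b → all24 b ≡ false → rhs m b ≡ + 0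
rhs-non24 m b b∉ = if-cong (cong (_∧ (weight b ≡ᵇ 2 * m)) b∉)

rhs-∷ʳ-2 : ∀ k c → weight c ≡ 2 * k →
  rhs (suc k) (c ∷ʳ 2) ≡ rhs k c +ℤ rhs (k ∸ 1) c +ℤ rhs k c
rhs-∷ʳ-2 zero [] w = refl
rhs-∷ʳ-2 zero (zero ∷ ys) w = refl
rhs-∷ʳ-2 (suc j) c@(y ∷ ys) w = begin
  rhs (suc (suc j)) (c ∷ʳ 2)                 ≡⟨ rhs-on (suc (suc j)) (c ∷ʳ 2) weight-c∷ʳ2 ⟩
  coeff (c ∷ʳ 2)                             ≡⟨ coeff-∷ʳ-2 y ys ⟩
  coeff c +ℤ coeff c                         ≡⟨ cong (_+ℤ coeff c) (ℤ.+-identityʳ (coeff c)) ⟨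
  coeff c +ℤ + 0 +ℤ coeff c                  ≡⟨ cong₂ (λ u v → u +ℤ v +ℤ u) (rhs-on (suc j) c w) rhs-j ⟨
  rhs (suc j) c +ℤ rhs j c +ℤ rhs (suc j) c  ∎
  where
  open ≡-Reasoning
  weight-c∷ʳ2 : weight (c ∷ʳ 2) ≡ 2 * suc (suc j)
  weight-c∷ʳ2 = trans (weight-∷ʳ c 2) (trans (cong (_+ 2) w) (sym (2*-suc (suc j))))
  rhs-j : rhs j c ≡ + 0
  rhs-j = rhs-off j c (2*-suc≢2* j ∘ trans (sym w))

rhs-∷ʳ-4 : ∀ k c → weight c + 4 ≡ 2 * suc k →
  rhs (suc k) (c ∷ʳ 4) ≡ rhs k c +ℤ rhs (k ∸ 1) c +ℤ rhs k c
rhs-∷ʳ-4 zero c w = contradiction (trans (+-comm 4 (weight c)) w) λ ()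
rhs-∷ʳ-4 (suc j) c w = begin
  rhs (suc (suc j)) (c ∷ʳ 4)                 ≡⟨ rhs-on (suc (suc j)) (c ∷ʳ 4) (trans (weight-∷ʳ c 4) w) ⟩
  coeff (c ∷ʳ 4)                             ≡⟨ coeff-∷ʳ-4 c ⟩
  coeff c                                    ≡⟨ trans (ℤ.+-identityʳ _) (ℤ.+-identityˡ (coeff c)) ⟨
  + 0 +ℤ coeff c +ℤ + 0                      ≡⟨ cong₂ (λ u v → u +ℤ v +ℤ u) rhs-suc-j (rhs-on j c wc) ⟨
  rhs (suc j) c +ℤ rhs j c +ℤ rhs (suc j) c  ∎
  where
  open ≡-Reasoning
  wc : weight c ≡ 2 * j
  wc = +-cancelʳ-≡ 4 (weight c) (2 * j) (trans w (2*-suc-suc j))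
  rhs-suc-j : rhs (suc j) c ≡ + 0
  rhs-suc-j = rhs-off (suc j) c λ w′ → 2*-suc≢2* j (trans (sym w′) wc)

rhs-∷ʳ-other : ∀ k c x → weight c + x ≡ 2 * suc k → x ≢ 2 → x ≢ 4 →
  rhs (suc k) (c ∷ʳ x) ≡ rhs k c +ℤ rhs (k ∸ 1) c +ℤ rhs k c
rhs-∷ʳ-other k c x w x≢2 x≢4 =
  trans (rhs-non24 (suc k) (c ∷ʳ x) (all24-∷ʳ-false c (is24-false x x≢2 x≢4)))
        (sym (cong₂ (λ u v → u +ℤ v +ℤ u) (rhs-off k c weight≢2k)
                                           (rhs-off (k ∸ 1) c (weight≢2[k∸1] k w))))
  where
  weight≢2k : weight c ≢ 2 * k
  weight≢2k wc = x≢2 (+-cancel-≡ wc (trans w (2*-suc k)))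
  weight≢2[k∸1] : ∀ i → weight c + x ≡ 2 * suc i → weight c ≢ 2 * (i ∸ 1)
  weight≢2[k∸1] zero w′ wc = x≢2 (+-cancel-≡ wc w′)
  weight≢2[k∸1] (suc j) w′ wc = x≢4 (+-cancel-≡ wc (trans w′ (2*-suc-suc j)))

rhs-∷ʳ : ∀ k c x → weight c + x ≡ 2 * suc k →
  rhs (suc k) (c ∷ʳ x) ≡ rhs k c +ℤ rhs (k ∸ 1) c +ℤ rhs k c
rhs-∷ʳ k c x w with x ≟ 2 | x ≟ 4
... | yes refl | _        = rhs-∷ʳ-2 k c (+-cancelʳ-≡ 2 (weight c) (2 * k) (trans w (2*-suc k)))
... | no _     | yes refl = rhs-∷ʳ-4 k c w
... | no x≢2   | no x≢4   = rhs-∷ʳ-other k c x w x≢2 x≢4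

rhs-init⁻¹ : ∀ k → rhs (suc k) ≗ init⁻¹ (2 * suc k) (rhs k ⊕ rhs (k ∸ 1) ⊕ rhs k)
rhs-init⁻¹ k b with reverseView b
... | [] = refl
... | c ∶ _ ∶ʳ x =
  trans (rhs-∷ʳ-guarded x) (sym (init⁻¹-∷ʳ (2 * suc k) (rhs k ⊕ rhs (k ∸ 1) ⊕ rhs k) c x))
  where
  rhs-∷ʳ-guarded : ∀ x → rhs (suc k) (c ∷ʳ x) ≡
    (if (weight c + x ≡ᵇ 2 * suc k) ∧ (1 ≤ᵇ x) then rhs k c +ℤ rhs (k ∸ 1) c +ℤ rhs k c else + 0)
  rhs-∷ʳ-guarded zero =
    trans (rhs-non24 (suc k) (c ∷ʳ 0) (all24-∷ʳ-false c refl))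
          (sym (if-cong (∧-zeroʳ (weight c + 0 ≡ᵇ 2 * suc k))))
  rhs-∷ʳ-guarded x@(suc _) with weight c + x ≟ 2 * suc k
  ... | yes w = trans (rhs-∷ʳ k c x w) (sym (if-cong (cong (_∧ true) (≡ᵇ-true w))))
  ... | no w≢ = trans (rhs-off (suc k) (c ∷ʳ x) (w≢ ∘ trans (sym (weight-∷ʳ c x))))
                      (sym (if-cong (cong (_∧ true) (≡ᵇ-false w≢))))

δfuel-replicate-2 : ∀ n k → k ≤ n → δfuel n (replicate k 2) ≗ rhs k
δfuel-replicate-2 n zero _ [] = refl
δfuel-replicate-2 n zero _ (zero ∷ _) = refl
δfuel-replicate-2 n zero _ b@(suc _ ∷ _) = sym (rhs-off 0 b λ ())
δfuel-replicate-2 (suc n) (suc k) (s≤s k≤n) b = begin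
  δfuel (suc n) a b
    ≡⟨ δfuel-∷ n 2 (replicate k 2) b ⟩
  init⁻¹ (weight a) (δfuel n (init a) ⊕ δfuel n (mid a) ⊕ δfuel n (fin a)) b
    ≡⟨ init⁻¹-cong (weight-replicate-2 (suc k)) δ-init-mid-fin b ⟩
  init⁻¹ (2 * suc k) (rhs k ⊕ rhs (k ∸ 1) ⊕ rhs k) b
    ≡⟨ rhs-init⁻¹ k b ⟨
  rhs (suc k) b
    ∎
  where
  open ≡-Reasoning
  a = replicate (suc k) 2
  δfuel-n : ∀ {a′ j} → a′ ≡ replicate j 2 → j ≤ n → δfuel n a′ ≗ rhs j
  δfuel-n refl j≤n = δfuel-replicate-2 n _ j≤n
  δ-init-mid-fin :
    δfuel n (init a) ⊕ δfuel n (mid a) ⊕ δfuel n (fin a) ≗ rhs k ⊕ rhs (k ∸ 1) ⊕ rhs k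
  δ-init-mid-fin c = cong₂ _+ℤ_
    (cong₂ _+ℤ_ (δfuel-n (init-replicate (suc k) 2) k≤n c)
                (δfuel-n (mid-replicate-2 (suc k)) (≤-trans (m∸n≤m k 1) k≤n) c))
    (δfuel-n (fin-replicate-2 (suc k)) k≤n c)

theorem14 : (m : ℕ) → (b : Composition) → δ (replicate m 2) b ≡ rhs m b
theorem14 m = δfuel-replicate-2 (weight (replicate m 2)) m m≤weight
  where
  m≤weight : m ≤ weight (replicate m 2)
  m≤weight = subst (m ≤_) (sym (weight-replicate-2 m)) (m≤m+n m (m + 0))
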